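{- Let ${\bf x}$ be an $(\varepsilon,\delta)$-AMFM of a graph $G=(V,E)$ satisfying ${\bf x}_{\min}\ge\delta$. Then $K=(V,\mathrm{supp}({\bf x}))$ is an $(\varepsilon,\delta^{ -1})$-kernel of $G$.
   Context: For ${\bf x}\in\mathbb{R}^E_{\ge0}$ write $x(v)=\sum_{e\ni v}x_e$, $\mathrm{supp}({\bf x})=\{e:x_e>0\}$, ${\bf x}_{\min}=\min_{e\in\mathrm{supp}({\bf x})}x_e$; ${\bf x}$ is a fractional matching if $x(v)\le1$ for all $v$. A fractional matching ${\bf x}$ is an $(\varepsilon,\delta)$-almost-maximal fractional matching ($(\varepsilon,\delta)$-AMFM) if for each edge $e\in E$, either $x_e\ge\delta$ or some endpoint $v\in e$ satisfies both $x(v)\ge1-\varepsilon$ and $\max_{f\ni v}x_f\le\delta$. An $(\varepsilon,d)$-kernel of $G$ is a subgraph $K=(V,E_K)$ with $E_K\subseteq E$ such that $d_K(v)\le d$ for every $v\in V$, and $\max_{v\in e}d_K(v)\ge d(1-\varepsilon)$ for every edge $e\in E\setminus E_K$, where $d_K(v)$ is the degree of $v$ in $K$.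
   Formalization: The fractional matching takes values in ℚ rather than ℝ, and the parameters ε and δ are rational. -}

module Defs where

open import Data.Nat as ℕ using (ℕ; zero; suc)
open import Data.Integer using (+_)
open import Data.Fin using (Fin; zero; suc; _≟_)
open import Data.Product using (_×_; _,_; proj₁; proj₂; Σ)
open import Data.Sum using (_⊎_)
open import Data.Bool using (Bool; true; false; if_then_else_; _∨_; _∧_)
open import Relation.Nullary using (¬_; does)
open import Relation.Binary.PropositionalEquality using (_≡_)
open import Data.Rational using (ℚ; 0ℚ; 1ℚ; _+_; _-_; _*_; _≤_; _<_; _/_)
open import Data.Rational.Properties using (_<?_)

record Graph : Set where
  field
    n : ℕ
    m : ℕ
    ends : Fin m → Fin n × Fin n
    loopless : ∀ e → ¬ (proj₁ (ends e) ≡ proj₂ (ends e))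
    simple : ∀ e f → ((proj₁ (ends e) ≡ proj₁ (ends f)) × (proj₂ (ends e) ≡ proj₂ (ends f)))
                   ⊎ ((proj₁ (ends e) ≡ proj₂ (ends f)) × (proj₂ (ends e) ≡ proj₁ (ends f)))
                   → e ≡ f

open Graph public

sumFin : (k : ℕ) → (Fin k → ℚ) → ℚ
sumFin zero f = 0ℚ
sumFin (suc k) f = f zero + sumFin k (λ i → f (suc i))

countFin : (k : ℕ) → (Fin k → Bool) → ℕ
countFin zero P = zero
countFin (suc k) P = (if P zero then 1 else 0) ℕ.+ countFin k (λ i → P (suc i))

ℕtoℚ : ℕ → ℚ
ℕtoℚ k = + k / 1

module _ (G : Graph) where

  incident : Fin (m G) → Fin (n G) → Bool
  incident e v = does (proj₁ (ends G e) ≟ v) ∨ does (proj₂ (ends G e) ≟ v)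

  _∈ₑ_ : Fin (n G) → Fin (m G) → Set
  v ∈ₑ e = incident e v ≡ true

  load : (Fin (m G) → ℚ) → Fin (n G) → ℚ
  load x v = sumFin (m G) (λ e → if incident e v then x e else 0ℚ)

  IsFractionalMatching : (Fin (m G) → ℚ) → Set
  IsFractionalMatching x = (∀ e → 0ℚ ≤ x e) × (∀ v → load x v ≤ 1ℚ)

  inSupp : (Fin (m G) → ℚ) → Fin (m G) → Bool
  inSupp x e = does (0ℚ <? x e)

  MinAtLeast : (Fin (m G) → ℚ) → ℚ → Set
  MinAtLeast x δ = ∀ e → inSupp x e ≡ true → δ ≤ x e

  IsAMFM : ℚ → ℚ → (Fin (m G) → ℚ) → Set
  IsAMFM ε δ x =
    IsFractionalMatching x ×
    (∀ e → δ ≤ x e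
         ⊎ Σ (Fin (n G)) (λ v → v ∈ₑ e × (1ℚ - ε ≤ load x v) × (∀ f → v ∈ₑ f → x f ≤ δ)))

  -- degree of v in the spanning subgraph K = (V, E_K), E_K given by a Boolean predicate
  degIn : (Fin (m G) → Bool) → Fin (n G) → ℕ
  degIn inK v = countFin (m G) (λ e → inK e ∧ incident e v)

  IsKernel : ℚ → ℚ → (Fin (m G) → Bool) → Set
  IsKernel ε d inK =
    (∀ v → ℕtoℚ (degIn inK v) ≤ d) ×
    (∀ e → inK e ≡ false →
       d * (1ℚ - ε) ≤ ℕtoℚ (degIn inK (proj₁ (ends G e)) ℕ.⊔ degIn inK (proj₂ (ends G e))))

{-# OPTIONS --safe #-}
-- A support edge carries weight at least δ, so δ · deg_K(v) ≤ x(v) ≤ 1.  An edge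
-- outside the support has weight 0 < δ, so the AMFM condition yields an endpoint v
-- with x(v) ≥ 1 - ε all of whose edges carry at most δ; then
-- 1 - ε ≤ x(v) ≤ δ · deg_K(v).
module Submission where

open import Defs
open import Data.Bool using (Bool; true; false; if_then_else_; _∧_)
open import Data.Bool.Properties using (not-¬)
open import Data.Empty using (⊥-elim)
open import Data.Fin using (Fin; zero; suc; _≟_)
open import Data.Integer as ℤ using (+_)
open import Data.Integer.Properties as ℤ using (pos-+)
open import Data.Nat as ℕ using (ℕ; zero; suc; _⊔_)
open import Data.Nat.Properties using (m≤n⇒∃[o]m+o≡n; m≤m⊔n; m≤n⊔m)
open import Data.Product using (_,_; proj₁; proj₂)
open import Data.Rational using (ℚ; Positive; 1/_; 0ℚ; 1ℚ; _+_; _-_; _*_; _≤_; toℚᵘ)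
open import Data.Rational.Properties
  using ( ≤-refl; ≤-trans; ≤-reflexive; ≮⇒≥; <-irrefl; ≤-<-trans; +-mono-≤; +-monoʳ-≤; +-identityʳ
        ; *-identityˡ; *-zeroˡ; *-distribʳ-+; *-assoc; *-comm; *-inverseˡ; *-inverseʳ
        ; *-cancelʳ-≤-pos; *-cancelˡ-≤-pos; normalize-nonNeg; nonNegative⁻¹; positive⁻¹
        ; toℚᵘ-injective; toℚᵘ-fromℚᵘ; toℚᵘ-homo-+; pos⇒nonZero; _<?_; module ≤-Reasoning )
import Data.Rational.Unnormalised as ℚᵘ
import Data.Rational.Unnormalised.Properties as ℚᵘ
open import Data.Sum using (_⊎_; inj₁; inj₂)
open import Relation.Nullary using (yes; no; does)
open import Relation.Nullary.Decidable using (dec-true)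
open import Relation.Binary.PropositionalEquality
  using (_≡_; refl; sym; cong; cong₂; subst; module ≡-Reasoning)

ℕtoℚ-+ : ∀ a b → ℕtoℚ (a ℕ.+ b) ≡ ℕtoℚ a + ℕtoℚ b
ℕtoℚ-+ a b = toℚᵘ-injective images-≃
  where
  numerators : + (a ℕ.+ b) ℤ.* + 1 ≡ (+ a ℤ.* + 1 ℤ.+ + b ℤ.* + 1) ℤ.* + 1
  numerators = begin
    + (a ℕ.+ b) ℤ.* + 1                      ≡⟨ ℤ.*-identityʳ _ ⟩
    + (a ℕ.+ b)                              ≡⟨ pos-+ a b ⟩
    + a ℤ.+ + b                              ≡⟨ sym (cong₂ ℤ._+_ (ℤ.*-identityʳ (+ a)) (ℤ.*-identityʳ (+ b))) ⟩
    + a ℤ.* + 1 ℤ.+ + b ℤ.* + 1              ≡⟨ sym (ℤ.*-identityʳ _) ⟩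
    (+ a ℤ.* + 1 ℤ.+ + b ℤ.* + 1) ℤ.* + 1    ∎
    where open ≡-Reasoning

  images-≃ : toℚᵘ (ℕtoℚ (a ℕ.+ b)) ℚᵘ.≃ toℚᵘ (ℕtoℚ a + ℕtoℚ b)
  images-≃ = begin-equality
    toℚᵘ (ℕtoℚ (a ℕ.+ b))                ≃⟨ toℚᵘ-fromℚᵘ (ℚᵘ.mkℚᵘ (+ (a ℕ.+ b)) 0) ⟩
    ℚᵘ.mkℚᵘ (+ (a ℕ.+ b)) 0              ≃⟨ ℚᵘ.*≡* numerators ⟩
    ℚᵘ.mkℚᵘ (+ a) 0 ℚᵘ.+ ℚᵘ.mkℚᵘ (+ b) 0  ≃⟨ ℚᵘ.≃-sym (ℚᵘ.+-cong (toℚᵘ-fromℚᵘ (ℚᵘ.mkℚᵘ (+ a) 0)) (toℚᵘ-fromℚᵘ (ℚᵘ.mkℚᵘ (+ b) 0))) ⟩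
    toℚᵘ (ℕtoℚ a) ℚᵘ.+ toℚᵘ (ℕtoℚ b)      ≃⟨ ℚᵘ.≃-sym (toℚᵘ-homo-+ (ℕtoℚ a) (ℕtoℚ b)) ⟩
    toℚᵘ (ℕtoℚ a + ℕtoℚ b)               ∎
    where open ℚᵘ.≤-Reasoning

ℕtoℚ-nonNeg : ∀ a → 0ℚ ≤ ℕtoℚ a
ℕtoℚ-nonNeg a = nonNegative⁻¹ (ℕtoℚ a) {{normalize-nonNeg a 1}}

ℕtoℚ-mono-≤ : ∀ {a b} → a ℕ.≤ b → ℕtoℚ a ≤ ℕtoℚ b
ℕtoℚ-mono-≤ {a} a≤b with m≤n⇒∃[o]m+o≡n a≤b
... | d , refl = begin
  ℕtoℚ a             ≡⟨ sym (+-identityʳ (ℕtoℚ a)) ⟩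
  ℕtoℚ a + 0ℚ        ≤⟨ +-monoʳ-≤ (ℕtoℚ a) (ℕtoℚ-nonNeg d) ⟩
  ℕtoℚ a + ℕtoℚ d    ≡⟨ sym (ℕtoℚ-+ a d) ⟩
  ℕtoℚ (a ℕ.+ d)     ∎
  where open ≤-Reasoning

if≡ℕtoℚ-if-* : ∀ b c → (if b then c else 0ℚ) ≡ ℕtoℚ (if b then 1 else 0) * c
if≡ℕtoℚ-if-* true  c = sym (*-identityˡ c)
if≡ℕtoℚ-if-* false c = sym (*-zeroˡ c)

sumFin-if≡countFin-* : ∀ k (P : Fin k → Bool) c →
  sumFin k (λ i → if P i then c else 0ℚ) ≡ ℕtoℚ (countFin k P) * c
sumFin-if≡countFin-* zero    P c = sym (*-zeroˡ c)
sumFin-if≡countFin-* (suc k) P c = begin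
  (if P zero then c else 0ℚ) + sumFin k (λ i → if P (suc i) then c else 0ℚ)
    ≡⟨ cong₂ _+_ (if≡ℕtoℚ-if-* (P zero) c) (sumFin-if≡countFin-* k (λ i → P (suc i)) c) ⟩
  ℕtoℚ first * c + ℕtoℚ rest * c
    ≡⟨ sym (*-distribʳ-+ c (ℕtoℚ first) (ℕtoℚ rest)) ⟩
  (ℕtoℚ first + ℕtoℚ rest) * c
    ≡⟨ cong (_* c) (sym (ℕtoℚ-+ first rest)) ⟩
  ℕtoℚ (first ℕ.+ rest) * c ∎
  where
  open ≡-Reasoning
  first rest : ℕ
  first = if P zero then 1 else 0
  rest  = countFin k (λ i → P (suc i))

sumFin-mono-≤ : ∀ k {f g : Fin k → ℚ} → (∀ i → f i ≤ g i) → sumFin k f ≤ sumFin k g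
sumFin-mono-≤ zero    f≤g = ≤-refl
sumFin-mono-≤ (suc k) f≤g = +-mono-≤ (f≤g zero) (sumFin-mono-≤ k (λ i → f≤g (suc i)))

p*r≤1⇒p≤1/r : ∀ {p} r .{{_ : Positive r}} → p * r ≤ 1ℚ → p ≤ 1/_ r {{pos⇒nonZero r}}
p*r≤1⇒p≤1/r r pr≤1 = *-cancelʳ-≤-pos r (≤-trans pr≤1 (≤-reflexive (sym (*-inverseˡ r))))
  where instance _ = pos⇒nonZero r

q≤p*r⇒1/r*q≤p : ∀ {p q} r .{{_ : Positive r}} → q ≤ p * r → 1/_ r {{pos⇒nonZero r}} * q ≤ p
q≤p*r⇒1/r*q≤p {p} {q} r q≤pr = *-cancelˡ-≤-pos r (begin
  r * (1/ r * q)   ≡⟨ sym (*-assoc r (1/ r) q) ⟩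
  r * 1/ r * q     ≡⟨ cong (_* q) (*-inverseʳ r) ⟩
  1ℚ * q           ≡⟨ *-identityˡ q ⟩
  q                ≤⟨ q≤pr ⟩
  p * r            ≡⟨ *-comm p r ⟩
  r * p            ∎)
  where
  instance _ = pos⇒nonZero r
  open ≤-Reasoning

0<?-false⇒≤0 : ∀ q → does (0ℚ <? q) ≡ false → q ≤ 0ℚ
0<?-false⇒≤0 q 0≮?q = ≮⇒≥ λ 0<q → not-¬ (dec-true (0ℚ <? q) 0<q) 0≮?q

module _ (G : Graph) where

  ∈ₑ⇒endpoint : ∀ {v e} → _∈ₑ_ G v e → proj₁ (ends G e) ≡ v ⊎ proj₂ (ends G e) ≡ v
  ∈ₑ⇒endpoint {v} {e} v∈e with proj₁ (ends G e) ≟ v | proj₂ (ends G e) ≟ v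
  ... | yes u≡v | _       = inj₁ u≡v
  ... | no _    | yes w≡v = inj₂ w≡v

  ≤-endpoint-⊔ : ∀ (f : Fin (n G) → ℕ) {v e} → _∈ₑ_ G v e →
    f v ℕ.≤ f (proj₁ (ends G e)) ⊔ f (proj₂ (ends G e))
  ≤-endpoint-⊔ f v∈e with ∈ₑ⇒endpoint v∈e
  ... | inj₁ refl = m≤m⊔n _ _
  ... | inj₂ refl = m≤n⊔m _ _

  module _ (x : Fin (m G) → ℚ) where

    supportDegree : Fin (n G) → ℕ
    supportDegree = degIn G (inSupp G x)

    ∉supp⇒≤0 : ∀ e → inSupp G x e ≡ false → x e ≤ 0ℚ
    ∉supp⇒≤0 e = 0<?-false⇒≤0 (x e)

    supportDegree-*-≤-load : ∀ {δ} → (∀ e → 0ℚ ≤ x e) → MinAtLeast G x δ →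
      ∀ v → ℕtoℚ (supportDegree v) * δ ≤ load G x v
    supportDegree-*-≤-load {δ} x≥0 x≥δ v =
      subst (_≤ load G x v) (sumFin-if≡countFin-* (m G) _ δ) (sumFin-mono-≤ (m G) pointwise)
      where
      pointwise : ∀ e → (if inSupp G x e ∧ incident G e v then δ else 0ℚ)
                      ≤ (if incident G e v then x e else 0ℚ)
      pointwise e with inSupp G x e in e∈K | incident G e v
      ... | true  | true  = x≥δ e e∈K
      ... | true  | false = ≤-refl
      ... | false | true  = x≥0 e
      ... | false | false = ≤-refl

    load-≤-supportDegree-* : ∀ {δ} v → (∀ f → _∈ₑ_ G v f → x f ≤ δ) →
      load G x v ≤ ℕtoℚ (supportDegree v) * δ
    load-≤-supportDegree-* {δ} v x≤δ =
      subst (load G x v ≤_) (sumFin-if≡countFin-* (m G) _ δ) (sumFin-mono-≤ (m G) pointwise)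
      where
      pointwise : ∀ e → (if incident G e v then x e else 0ℚ)
                      ≤ (if inSupp G x e ∧ incident G e v then δ else 0ℚ)
      pointwise e with inSupp G x e in e∈K | incident G e v in v∈e
      ... | true  | true  = x≤δ e v∈e
      ... | true  | false = ≤-refl
      ... | false | true  = ∉supp⇒≤0 e e∈K
      ... | false | false = ≤-refl

lemma6p5 : (G : Graph) (ε δ : ℚ) .{{δpos : Positive δ}} (x : Fin (m G) → ℚ) →
    IsAMFM G ε δ x → MinAtLeast G x δ →
    IsKernel G ε (1/_ δ {{pos⇒nonZero δ}}) (inSupp G x)
lemma6p5 G ε δ x ((x≥0 , load≤1) , almostMaximal) x≥δ = degree≤1/δ , saturated
  where
  deg : Fin (n G) → ℕ
  deg = supportDegree G x

  degree≤1/δ : ∀ v → ℕtoℚ (deg v) ≤ 1/_ δ {{pos⇒nonZero δ}}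
  degree≤1/δ v = p*r≤1⇒p≤1/r δ (≤-trans (supportDegree-*-≤-load G x x≥0 x≥δ v) (load≤1 v))

  saturated : ∀ e → inSupp G x e ≡ false →
    1/_ δ {{pos⇒nonZero δ}} * (1ℚ - ε) ≤ ℕtoℚ (deg (proj₁ (ends G e)) ⊔ deg (proj₂ (ends G e)))
  saturated e e∉K with almostMaximal e
  ... | inj₁ δ≤xe = ⊥-elim (<-irrefl refl (≤-<-trans (≤-trans δ≤xe (∉supp⇒≤0 G x e e∉K)) (positive⁻¹ δ)))
  ... | inj₂ (v , v∈e , 1-ε≤load , light) =
    ≤-trans (q≤p*r⇒1/r*q≤p δ (≤-trans 1-ε≤load (load-≤-supportDegree-* G x v light)))
            (ℕtoℚ-mono-≤ (≤-endpoint-⊔ G deg v∈e))
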